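{- Let ${\cal D}$ be a balanced quadriculated disk with $|{\cal D}|$ unit squares, let $N\ge 2|{\cal D}|$ be an integer and let $p$ be a plug. Then both corks ${\cal R}_{0,N;{\mathbf p_\circ},p}$ and ${\cal R}_{0,N;p,{\mathbf p_\circ}}$ admit domino tilings.
   Context: A quadriculated disk ${\cal D}\subset\mathbb{R}^2$ is a finite union of unit squares $[a,a+1]\times[b,b+1]$, $(a,b)\in\mathbb{Z}^2$, contractible with contractible interior; squares have color $(-1)^{a+b}$ and ${\cal D}$ is balanced if it has equally many squares of each color. A plug is a union $p\subseteq{\cal D}$ of unit squares of ${\cal D}$ containing equally many squares of each color (possibly empty); ${\mathbf p_\circ}=\emptyset$ denotes the empty plug. For integers $N_1\ge N_0+2$ and plugs $p,\tilde p$, the cork is ${\cal R}_{N_0,N_1;p,\tilde p}=({\cal D}\times[N_0,N_1])\setminus\operatorname{int}((p\times[N_0,N_0+1])\cup(\tilde p\times[N_1-1,N_1]))$. A (3D) domino is the union of two unit cubes with integer vertices sharing a face; a tiling of a region is a set of dominoes with disjoint interiors whose union is the region. -}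

module Defs where

open import Data.Bool using (Bool; not)
open import Data.Nat as ℕ using (ℕ; _%_)
open import Data.Integer using (ℤ; +_; _+_; _-_; ∣_∣; _≤_; _<_)
open import Data.Product using (_×_; _,_; Σ)
open import Data.List using (List; []; _∷_; length; filterᵇ; concatMap)
open import Data.List.Membership.Propositional using (_∈_; _∉_)
open import Data.List.Relation.Unary.Unique.Propositional using (Unique)
open import Data.List.Relation.Unary.All using (All)
open import Relation.Binary.PropositionalEquality using (_≡_; _≢_)
open import Relation.Nullary using (¬_)
open import Data.Nat using (_≡ᵇ_)
open import Function.Bundles using (_⇔_)

-- A unit square [a,a+1]×[b,b+1] is identified with its corner (a , b).
Square : Set
Square = ℤ × ℤ

-- A unit cube [a,a+1]×[b,b+1]×[c,c+1] is identified with (a , b , c).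
Cube : Set
Cube = ℤ × ℤ × ℤ

-- color (-1)^(a+b): true means color +1 (a+b even), false means -1.
isEven : Square → Bool
isEven (a , b) = (∣ a + b ∣ % 2) ≡ᵇ 0

count : (Square → Bool) → List Square → ℕ
count f l = length (filterᵇ f l)

Balanced : List Square → Set
Balanced l = count isEven l ≡ count (λ s → not (isEven s)) l

Adjacent : Square → Square → Set
Adjacent (a , b) (c , d) = ∣ a - c ∣ ℕ.+ ∣ b - d ∣ ≡ 1

data Path (P : Square → Set) : Square → Square → Set where
  here : ∀ {x} → P x → Path P x x
  step : ∀ {x y z} → P x → Adjacent x y → Path P y z → Path P x z

EdgeConnected : (Square → Set) → Set
EdgeConnected P = ∀ x y → P x → P y → Path P x y

-- A finite set of unit squares (given as a duplicate-free list) whose union is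
-- contractible with contractible interior.
IsQuadDisk : List Square → Set
IsQuadDisk D =
  Unique D × (D ≢ []) × EdgeConnected (λ s → s ∈ D) × EdgeConnected (λ s → s ∉ D)

IsPlug : List Square → List Square → Set
IsPlug D p = Unique p × All (λ s → s ∈ D) p × Balanced p

InCork : List Square → ℤ → ℤ → List Square → List Square → Cube → Set
InCork D N₀ N₁ p p̃ (a , b , c) =
  ((a , b) ∈ D) × (N₀ ≤ c) × (c < N₁)
  × ¬ ((c ≡ N₀) × ((a , b) ∈ p))
  × ¬ ((c ≡ N₁ - + 1) × ((a , b) ∈ p̃))

AdjacentCubes : Cube → Cube → Set
AdjacentCubes (a , b , c) (a' , b' , c') = ∣ a - a' ∣ ℕ.+ ∣ b - b' ∣ ℕ.+ ∣ c - c' ∣ ≡ 1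

Domino : Set
Domino = Cube × Cube

cellsOf : List Domino → List Cube
cellsOf = concatMap (λ { (u , v) → u ∷ v ∷ [] })

IsTiling : (Cube → Set) → List Domino → Set
IsTiling R T =
  All (λ d → AdjacentCubes (Data.Product.proj₁ d) (Data.Product.proj₂ d)) T
  × Unique (cellsOf T)
  × (∀ x → (x ∈ cellsOf T) ⇔ R x)

Tileable : (Cube → Set) → Set
Tileable R = Σ (List Domino) (IsTiling R)

-- Read a cork as a stack of copies of D and fill it from the bottom.  Let
-- Region D m H be m full layers topped by a balanced H ⊆ D in layer m; it is
-- tileable when m = 2k and |H| ≤ 2k, by induction on k.  If H is empty, add
-- two layers of vertical dominoes.  Otherwise walk in D from a white to a
-- black square of H: two squares u, v of H of opposite colours that are
-- consecutive among the squares of H on the walk are joined by a simple path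
-- whose interior avoids H.  It has an odd number of edges, so horizontal
-- dominoes cover the whole path in one layer and its interior in the next (a
-- zigzag).  On top of Region D 2k (H ∖ {u , v}) put the zigzag, vertical
-- dominoes over the rest of layer 2k, and then vertical dominoes over H: the
-- result is Region D (2k+2) H.  The cork with a plug p on top is
-- Region D (N-1) (D ∖ p) (for even N, columns over D ∖ p are added on top of
-- Region D (N-2) p), and the cork with p at the bottom is the same region
-- with layers counted from the top.
module Submission where

open import Defs
open import Data.Bool using (Bool; true; false; not)
open import Data.Bool.Properties using (not-involutive; not-¬; ¬-not; T-≡) renaming (_≟_ to _≟ᵇ_)
open import Data.Empty using (⊥-elim)
open import Data.Integer as ℤ using (ℤ; +_; -[1+_]; ∣_∣; +≤+; +<+)
import Data.Integer.Properties as ℤP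
open import Data.Integer.Tactic.RingSolver using (solve-∀)
open import Data.List using (List; []; _∷_; _++_; length; filter; filterᵇ)
open import Data.List.Membership.Propositional using (_∈_; _∉_)
open import Data.List.Membership.Propositional.Properties using (∈-filter⁺; ∈-filter⁻; ∈-++⁻; ∈-++⁺ˡ; ∈-++⁺ʳ)
open import Data.List.Membership.Propositional.Properties.WithK using (unique∧set⇒bag)
open import Data.List.Properties using (filter-++; length-++; length-filter; concatMap-++)
open import Data.List.Relation.Binary.BagAndSetEquality using (∼bag⇒↭)
open import Data.List.Relation.Binary.Disjoint.Propositional using (Disjoint)
open import Data.List.Relation.Binary.Permutation.Propositional using (_↭_)
open import Data.List.Relation.Binary.Permutation.Propositional.Properties using (↭-length; filter-↭)
open import Data.List.Relation.Unary.All as All using (All; []; _∷_; lookup)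
import Data.List.Relation.Unary.All.Properties as All
open import Data.List.Relation.Unary.AllPairs using ([]; _∷_)
open import Data.List.Relation.Unary.Any using (here; there)
open import Data.List.Relation.Unary.Unique.Propositional using (Unique)
import Data.List.Relation.Unary.Unique.Propositional.Properties as Unique
open import Data.Nat as ℕ using (ℕ; zero; suc; _+_; _*_; _∸_; _%_; _≡ᵇ_; _<_; _≤_; z≤n; s≤s; ⌊_/2⌋)
import Data.Nat.Properties as ℕP
open import Data.Product using (Σ; ∃-syntax; _×_; _,_; proj₁; proj₂)
open import Data.Product.Properties using (≡-dec)
open import Data.Sum as Sum using (_⊎_; inj₁; inj₂)
open import Function.Base using (_∘_; _∘′_; case_of_)
open import Function.Bundles using (mk⇔; Equivalence)
open import Level using (0ℓ)
open import Relation.Binary.Definitions using (DecidableEquality)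
open import Relation.Binary.PropositionalEquality
open import Relation.Nullary using (¬_; yes; no; T?; contradiction)
open import Relation.Unary using (Pred; _⊆_; _≐_; _∪_; _∩_; ∅; ｛_｝)

private variable
  P : Square → Set
  x y z w : Square

isEvenℕ : ℕ → Bool
isEvenℕ n = n % 2 ≡ᵇ 0

isEvenℤ : ℤ → Bool
isEvenℤ i = isEvenℕ ∣ i ∣

isEvenℕ-suc : ∀ n → isEvenℕ (suc n) ≡ not (isEvenℕ n)
isEvenℕ-suc zero          = refl
isEvenℕ-suc (suc zero)    = refl
isEvenℕ-suc (suc (suc n)) = isEvenℕ-suc n

isEvenℤ-1+ : ∀ i → isEvenℤ (+ 1 ℤ.+ i) ≡ not (isEvenℤ i)
isEvenℤ-1+ (+ n)          = isEvenℕ-suc n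
isEvenℤ-1+ -[1+ zero ]    = refl
isEvenℤ-1+ -[1+ suc n ]   = trans (sym (not-involutive _)) (cong not (sym (isEvenℕ-suc (suc n))))

∣i∣+∣j∣≡1⇒i+j≡±1 : ∀ i j → ∣ i ∣ + ∣ j ∣ ≡ 1 → i ℤ.+ j ≡ + 1 ⊎ i ℤ.+ j ≡ -[1+ 0 ]
∣i∣+∣j∣≡1⇒i+j≡±1 (+ 0)    (+ 1)    refl = inj₁ refl
∣i∣+∣j∣≡1⇒i+j≡±1 (+ 0)    -[1+ 0 ] refl = inj₂ refl
∣i∣+∣j∣≡1⇒i+j≡±1 (+ 1)    (+ 0)    refl = inj₁ refl
∣i∣+∣j∣≡1⇒i+j≡±1 -[1+ 0 ] (+ 0)    refl = inj₂ refl

isEven-adjacent : Adjacent x y → isEven x ≡ not (isEven y)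
isEven-adjacent {a , b} {c , d} adj with ∣i∣+∣j∣≡1⇒i+j≡±1 (a ℤ.- c) (b ℤ.- d) adj
... | inj₁ δ≡1 = begin
  isEvenℤ (a ℤ.+ b)                  ≡⟨ cong isEvenℤ (trans (up a b c d) (cong (ℤ._+ (c ℤ.+ d)) δ≡1)) ⟩
  isEvenℤ (+ 1 ℤ.+ (c ℤ.+ d))        ≡⟨ isEvenℤ-1+ (c ℤ.+ d) ⟩
  not (isEvenℤ (c ℤ.+ d))            ∎
  where
  open ≡-Reasoning
  up : ∀ a b c d → a ℤ.+ b ≡ ((a ℤ.- c) ℤ.+ (b ℤ.- d)) ℤ.+ (c ℤ.+ d)
  up = solve-∀
... | inj₂ δ≡-1 = begin
  isEvenℤ (a ℤ.+ b)                  ≡⟨ not-involutive _ ⟨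
  not (not (isEvenℤ (a ℤ.+ b)))      ≡⟨ cong not (isEvenℤ-1+ (a ℤ.+ b)) ⟨
  not (isEvenℤ (+ 1 ℤ.+ (a ℤ.+ b)))  ≡⟨ cong (not ∘ isEvenℤ) (trans (down a b c d) (cong (λ δ → ℤ.- δ ℤ.+ (a ℤ.+ b)) δ≡-1)) ⟨
  not (isEvenℤ (c ℤ.+ d))            ∎
  where
  open ≡-Reasoning
  down : ∀ a b c d → c ℤ.+ d ≡ ℤ.- ((a ℤ.- c) ℤ.+ (b ℤ.- d)) ℤ.+ (a ℤ.+ b)
  down = solve-∀

isEven-adjacent² : Adjacent x y → Adjacent y z → isEven x ≡ isEven z
isEven-adjacent² {x} {y} {z} a b =
  trans (isEven-adjacent {x} {y} a) (trans (cong not (isEven-adjacent {y} {z} b)) (not-involutive _))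

∣i-i∣≡0 : ∀ i → ∣ i ℤ.- i ∣ ≡ 0
∣i-i∣≡0 i = cong ∣_∣ (ℤP.i≡j⇒i-j≡0 {i} refl)

Adjacent-irreflexive : ¬ Adjacent x x
Adjacent-irreflexive {a , b} adj with trans (sym (cong₂ _+_ (∣i-i∣≡0 a) (∣i-i∣≡0 b))) adj
... | ()

_≟ˢ_ : DecidableEquality Square
_≟ˢ_ = ≡-dec ℤ._≟_ ℤ._≟_

open import Data.List.Membership.DecPropositional _≟ˢ_ using (_∈?_; _∉?_)

infixl 6 _∖_
_∖_ : List Square → List Square → List Square
xs ∖ ys = filter (_∉? ys) xs

∈-∖⁺ : ∀ {s xs ys} → s ∈ xs → s ∉ ys → s ∈ xs ∖ ys
∈-∖⁺ = ∈-filter⁺ (_∉? _)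

∈-∖⁻ : ∀ {s xs ys} → s ∈ xs ∖ ys → s ∈ xs × s ∉ ys
∈-∖⁻ = ∈-filter⁻ (_∉? _)

∖-unique : ∀ {xs} ys → Unique xs → Unique (xs ∖ ys)
∖-unique ys = Unique.filter⁺ (_∉? ys)

↭-++-∖ : ∀ {xs ys} → Unique xs → Unique ys → All (_∈ xs) ys → xs ↭ ys ++ xs ∖ ys
↭-++-∖ {xs} {ys} xs! ys! ys⊆xs = ∼bag⇒↭ (unique∧set⇒bag xs! ys++xs∖ys! (mk⇔ split merge))
  where
  ys++xs∖ys! : Unique (ys ++ xs ∖ ys)
  ys++xs∖ys! = Unique.++⁺ ys! (∖-unique ys xs!) λ (s∈ys , s∈xs∖ys) → proj₂ (∈-∖⁻ {xs = xs} s∈xs∖ys) s∈ys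
  split : ∀ {s} → s ∈ xs → s ∈ ys ++ xs ∖ ys
  split {s} s∈xs with s ∈? ys
  ... | yes s∈ys = ∈-++⁺ˡ s∈ys
  ... | no  s∉ys = ∈-++⁺ʳ ys (∈-∖⁺ s∈xs s∉ys)
  merge : ∀ {s} → s ∈ ys ++ xs ∖ ys → s ∈ xs
  merge s∈ = Sum.[ lookup ys⊆xs , proj₁ ∘ ∈-∖⁻ ] (∈-++⁻ ys s∈)

count-++ : ∀ f xs ys → count f (xs ++ ys) ≡ count f xs + count f ys
count-++ f xs ys = trans (cong length (filter-++ (T? ∘ f) xs ys)) (length-++ (filterᵇ f xs))

count-↭ : ∀ f {xs ys} → xs ↭ ys → count f xs ≡ count f ys
count-↭ f = ↭-length ∘ filter-↭ (T? ∘ f)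

count+count-not≡length : ∀ f xs → count f xs + count (not ∘ f) xs ≡ length xs
count+count-not≡length f []       = refl
count+count-not≡length f (x ∷ xs) with f x
... | true  = cong suc (count+count-not≡length f xs)
... | false = trans (ℕP.+-suc _ _) (cong suc (count+count-not≡length f xs))

∃-count : ∀ f xs → 0 < count f xs → ∃[ s ] s ∈ xs × f s ≡ true
∃-count f xs 0<count with filterᵇ f xs in eq
... | s ∷ _ with ∈-filter⁻ (T? ∘ f) {xs = xs} (subst (s ∈_) (sym eq) (here refl))
...   | s∈xs , fs = s , s∈xs , Equivalence.to T-≡ fs

count-∖ : ∀ f {xs ys} → Unique xs → Unique ys → All (_∈ xs) ys → count f xs ≡ count f ys + count f (xs ∖ ys)
count-∖ f {xs} {ys} xs! ys! ys⊆xs = trans (count-↭ f (↭-++-∖ xs! ys! ys⊆xs)) (count-++ f ys (xs ∖ ys))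

∖-balanced : ∀ {xs ys} → Unique xs → Unique ys → All (_∈ xs) ys → Balanced xs → Balanced ys → Balanced (xs ∖ ys)
∖-balanced {xs} {ys} xs! ys! ys⊆xs xs-balanced ys-balanced = ℕP.+-cancelˡ-≡ (count isEven ys) _ _ (begin
  count isEven ys + count isEven (xs ∖ ys)                  ≡⟨ count-∖ isEven xs! ys! ys⊆xs ⟨
  count isEven xs                                           ≡⟨ xs-balanced ⟩
  count (not ∘ isEven) xs                                   ≡⟨ count-∖ (not ∘ isEven) xs! ys! ys⊆xs ⟩
  count (not ∘ isEven) ys + count (not ∘ isEven) (xs ∖ ys)  ≡⟨ cong (_+ count (not ∘ isEven) (xs ∖ ys)) ys-balanced ⟨
  count isEven ys + count (not ∘ isEven) (xs ∖ ys)          ∎)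
  where open ≡-Reasoning

Balanced-pair : isEven x ≡ not (isEven y) → Balanced (x ∷ y ∷ [])
Balanced-pair {x} {y} = opposite isEven {x} {y}
  where
  opposite : ∀ f {x y} → f x ≡ not (f y) → count f (x ∷ y ∷ []) ≡ count (not ∘ f) (x ∷ y ∷ [])
  opposite f {x} {y} c with f x
  ... | false with f y
  ...   | true  = refl
  ...   | false = contradiction c λ ()
  opposite f {x} {y} c | true with f y
  ...   | false = refl
  ...   | true  = contradiction c λ ()

balanced-opposite : ∀ {h hs} → Balanced (h ∷ hs) →
                    ∃[ s ] ∃[ t ] s ∈ h ∷ hs × t ∈ h ∷ hs × isEven s ≡ not (isEven t)
balanced-opposite {h} {hs} balanced
  with ∃-count isEven (h ∷ hs) 0<evens | ∃-count (not ∘ isEven) (h ∷ hs) (subst (0 <_) balanced 0<evens)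
  where
  0<evens : 0 < count isEven (h ∷ hs)
  0<evens = ℕP.n≢0⇒n>0 λ evens≡0 → ℕP.0≢1+n
    (trans (sym (cong₂ _+_ evens≡0 (trans (sym balanced) evens≡0))) (count+count-not≡length isEven (h ∷ hs)))
... | s , s∈ , even | t , t∈ , odd = s , t , s∈ , t∈ , trans even (sym odd)

parity : ∀ m → ∃[ k ] (m ≡ 2 * k ⊎ m ≡ suc (2 * k))
parity zero    = 0 , inj₁ refl
parity (suc m) with parity m
... | k , inj₁ refl = k , inj₂ refl
... | k , inj₂ refl = suc k , inj₁ (sym (ℕP.*-suc 2 k))

length-bound : ∀ xs k → Balanced xs → 2 * length xs ≤ 2 + 2 * k → length xs ≤ 2 * k
length-bound xs k balanced bound = begin
  length xs  ≡⟨ evens+evens ⟨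
  c + c      ≤⟨ ℕP.+-mono-≤ c≤k c≤k ⟩
  k + k      ≡⟨ cong (λ n → k + n) (ℕP.+-identityʳ k) ⟨
  2 * k      ∎
  where
  open ℕP.≤-Reasoning
  c = count isEven xs
  evens+evens : c + c ≡ length xs
  evens+evens = trans (cong (λ n → c + n) balanced) (count+count-not≡length isEven xs)
  c+c≤1+k : c + c ≤ suc k
  c+c≤1+k = subst (_≤ suc k) (sym evens+evens) (ℕP.*-cancelˡ-≤ 2 (subst (2 * length xs ≤_) (sym (ℕP.*-suc 2 k)) bound))
  c≤k : c ≤ k
  c≤k = begin
    c            ≡⟨ ℕP.n≡⌊n+n/2⌋ c ⟩
    ⌊ c + c /2⌋  ≤⟨ ℕP.⌊n/2⌋-mono c+c≤1+k ⟩
    ⌊ suc k /2⌋  ≤⟨ ℕP.≤-pred (ℕP.⌊n/2⌋<n k) ⟩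
    k            ∎

pathVertices : Path P x y → List Square
pathVertices (here {x} _)     = x ∷ []
pathVertices (step {x} _ _ q) = x ∷ pathVertices q

pathVertices-All : (q : Path P x y) → All P (pathVertices q)
pathVertices-All (here px)     = px ∷ []
pathVertices-All (step px _ q) = px ∷ pathVertices-All q

Path-source : Path P x y → P x
Path-source (here px)     = px
Path-source (step px _ _) = px

Path-target : Path P x y → P y
Path-target (here py)    = py
Path-target (step _ _ q) = Path-target q

Path-map : ∀ {Q : Square → Set} → (∀ {s} → P s → Q s) → Path P x y → Path Q x y
Path-map f (here px)     = here (f px)
Path-map f (step px a q) = step (f px) a (Path-map f q)

Path-snoc : Path P x y → Adjacent y z → P z → Path P x z
Path-snoc (here px)     a pz = step px a (here pz)
Path-snoc (step px b q) a pz = step px b (Path-snoc q a pz)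

SimplePath : (Square → Set) → Square → Square → Set
SimplePath P x y = Σ (Path P x y) (Unique ∘ pathVertices)

suffixFrom : (q : Path P y z) → Unique (pathVertices q) → x ∈ pathVertices q → SimplePath P x z
suffixFrom q@(here _)     q!       (here refl) = q , q!
suffixFrom q@(step _ _ _) q!       (here refl) = q , q!
suffixFrom (step _ _ q)   (_ ∷ q!) (there x∈q) = suffixFrom q q! x∈q

eraseLoops : Path P x y → SimplePath P x y
eraseLoops (here px) = here px , [] ∷ []
eraseLoops {x = x} (step px a q) with eraseLoops q
... | q′ , q′! with x ∈? pathVertices q′
...   | yes x∈q′ = suffixFrom q′ q′! x∈q′
...   | no  x∉q′ = step px a q′ , All.¬Any⇒All¬ _ x∉q′ ∷ q′!

data OddWalk : Square → Square → Set where
  edge : Adjacent x y → OddWalk x y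
  zig  : Adjacent x y → Adjacent y z → OddWalk z w → OddWalk x w

vertices : OddWalk x y → List Square
vertices (edge {x} {y} _)    = x ∷ y ∷ []
vertices (zig {x} {y} _ _ e) = x ∷ y ∷ vertices e

interior : OddWalk x y → List Square
interior (edge _)                = []
interior (zig {y = y} {z} _ _ e) = y ∷ z ∷ interior e

vertices-ends : (e : OddWalk x y) → vertices e ≡ x ∷ interior e ++ y ∷ []
vertices-ends (edge _)    = refl
vertices-ends (zig _ _ e) = cong (λ vs → _ ∷ _ ∷ vs) (vertices-ends e)

source∈vertices : (e : OddWalk x y) → x ∈ vertices e
source∈vertices e = subst (_ ∈_) (sym (vertices-ends e)) (here refl)

target∈vertices : (e : OddWalk x y) → y ∈ vertices e
target∈vertices e = subst (_ ∈_) (sym (vertices-ends e)) (there (∈-++⁺ʳ (interior e) (here refl)))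

interior⊆vertices : (e : OddWalk x y) → ∀ {s} → s ∈ interior e → s ∈ vertices e
interior⊆vertices e s∈ = subst (_ ∈_) (sym (vertices-ends e)) (there (∈-++⁺ˡ s∈))

vertices-cases : (e : OddWalk x y) → ∀ {s} → s ∈ vertices e → s ≡ x ⊎ s ∈ interior e ⊎ s ≡ y
vertices-cases e s∈ with subst (_ ∈_) (vertices-ends e) s∈
... | here s≡x = inj₁ s≡x
... | there s∈ with ∈-++⁻ (interior e) s∈
...   | inj₁ s∈i        = inj₂ (inj₁ s∈i)
...   | inj₂ (here s≡y) = inj₂ (inj₂ s≡y)

∉-init : ∀ xs → Unique (xs ++ y ∷ []) → y ∉ xs
∉-init (x ∷ xs) (x∉ ∷ _)  (here y≡x) = lookup x∉ (∈-++⁺ʳ xs (here refl)) (sym y≡x)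
∉-init (x ∷ xs) (_ ∷ xs!) (there y∈) = ∉-init xs xs! y∈

interior-distinct : (e : OddWalk x y) → Unique (vertices e) → ∀ {s} → s ∈ interior e → s ≢ x × s ≢ y
interior-distinct e e! s∈ with subst Unique (vertices-ends e) e!
... | x∉ ∷ rest! = (λ s≡x → lookup x∉ (∈-++⁺ˡ s∈) (sym s≡x)) , λ { refl → ∉-init (interior e) rest! s∈ }

OddWalk-isEven : OddWalk x y → isEven x ≡ not (isEven y)
OddWalk-isEven (edge {x} {y} a)       = isEven-adjacent {x} {y} a
OddWalk-isEven (zig {x} {y} {z} a b e) = trans (isEven-adjacent² {x} {y} {z} a b) (OddWalk-isEven e)

toOddWalk : (q : Path P x y) → isEven x ≡ not (isEven y) → Σ (OddWalk x y) λ e → vertices e ≡ pathVertices q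
toOddWalk (here _)            c = ⊥-elim (not-¬ refl c)
toOddWalk (step _ a (here _)) c = edge a , refl
toOddWalk (step {x} {y} _ a (step {_} {z} _ b q)) c
  with toOddWalk q (trans (sym (isEven-adjacent² {x} {y} {z} a b)) c)
... | e , e≡q = zig a b e , cong (λ vs → _ ∷ _ ∷ vs) e≡q

record Bridge (D H : List Square) : Set where
  field
    source target : Square
    source∈H      : source ∈ H
    target∈H      : target ∈ H
    walk          : OddWalk source target
    walk-unique   : Unique (vertices walk)
    walk⊆D        : All (_∈ D) (vertices walk)
    interior∉H    : All (_∉ H) (interior walk)

  ends : List Square
  ends = source ∷ target ∷ []

  ends-unique : Unique ends
  ends-unique = ((λ s≡t → not-¬ (cong isEven s≡t) (OddWalk-isEven walk)) ∷ []) ∷ [] ∷ []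

  ends⊆H : All (_∈ H) ends
  ends⊆H = source∈H ∷ target∈H ∷ []

  ends-balanced : Balanced ends
  ends-balanced = Balanced-pair {source} {target} (OddWalk-isEven walk)

module _ (D H : List Square) where

  Avoiding : Square → Square → Square → Set
  Avoiding u v s = s ∈ D × (s ∉ H ⊎ s ≡ u ⊎ s ≡ v)

  bridge-from-path : ∀ {u v} → u ∈ H → v ∈ H → isEven u ≡ not (isEven v) → Path (Avoiding u v) u v → Bridge D H
  bridge-from-path {u} {v} u∈H v∈H c path = record
    { source∈H    = u∈H
    ; target∈H    = v∈H
    ; walk        = e
    ; walk-unique = subst Unique (sym e≡q) q!
    ; walk⊆D      = All.map proj₁ avoiding
    ; interior∉H  = All.tabulate interior∉H
    }
    where
    q : Path (Avoiding u v) u v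
    q = proj₁ (eraseLoops path)
    q! : Unique (pathVertices q)
    q! = proj₂ (eraseLoops path)
    e : OddWalk u v
    e = proj₁ (toOddWalk q c)
    e≡q : vertices e ≡ pathVertices q
    e≡q = proj₂ (toOddWalk q c)
    avoiding : All (Avoiding u v) (vertices e)
    avoiding = subst (All (Avoiding u v)) (sym e≡q) (pathVertices-All q)
    interior∉H : ∀ {s} → s ∈ interior e → s ∉ H
    interior∉H s∈ with interior-distinct e (subst Unique (sym e≡q) q!) s∈
                     | lookup avoiding (interior⊆vertices e s∈)
    ... | _   , _   | _ , inj₁ s∉H        = s∉H
    ... | s≢u , _   | _ , inj₂ (inj₁ s≡u) = ⊥-elim (s≢u s≡u)
    ... | _   , s≢v | _ , inj₂ (inj₂ s≡v) = ⊥-elim (s≢v s≡v)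

  -- acc runs from the last square x of H met so far to the current square y;
  -- x has the colour opposite to the target t, so some square of H on the
  -- way closes a bridge at the latest when t itself is reached.
  bridge-search : ∀ {t} → x ∈ H → isEven x ≡ not (isEven t) → Path (Avoiding x x) x y →
                  Path (_∈ D) y t → t ∈ H → Bridge D H
  bridge-search x∈H c acc (here _) t∈H with Path-target acc
  ... | _ , inj₁ t∉H         = ⊥-elim (t∉H t∈H)
  ... | _ , inj₂ (inj₁ refl) = ⊥-elim (not-¬ refl c)
  ... | _ , inj₂ (inj₂ refl) = ⊥-elim (not-¬ refl c)
  bridge-search {x} x∈H c acc (step {_} {y′} _ a rest) t∈H with y′ ∈? H
  ... | no y′∉H = bridge-search x∈H c (Path-snoc acc a (Path-source rest , inj₁ y′∉H)) rest t∈H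
  ... | yes y′∈H with isEven x ≟ᵇ isEven y′
  ...   | yes same   = bridge-search y′∈H (trans (sym same) c) (here (Path-source rest , inj₂ (inj₁ refl))) rest t∈H
  ...   | no  differ = bridge-from-path x∈H y′∈H (¬-not differ)
                         (Path-snoc (Path-map widen acc) a (Path-source rest , inj₂ (inj₂ refl)))
    where
    widen : ∀ {s} → Avoiding x x s → Avoiding x y′ s
    widen (s∈D , inj₁ s∉H)        = s∈D , inj₁ s∉H
    widen (s∈D , inj₂ (inj₁ s≡x)) = s∈D , inj₂ (inj₁ s≡x)
    widen (s∈D , inj₂ (inj₂ s≡x)) = s∈D , inj₂ (inj₁ s≡x)

  bridge : ∀ {s t} → EdgeConnected (_∈ D) → All (_∈ D) H → s ∈ H → t ∈ H → isEven s ≡ not (isEven t) → Bridge D H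
  bridge connected H⊆D s∈H t∈H c =
    bridge-search s∈H c (here (lookup H⊆D s∈H , inj₂ (inj₁ refl)))
      (connected _ _ (lookup H⊆D s∈H) (lookup H⊆D t∈H)) t∈H

-- `lower` and `upper` are the two layers of the slab laid over a bridge:
-- columns over `others` and the zigzag along the walk.
module BridgeLayers {D H : List Square} (H⊆D : All (_∈ D) H) (b : Bridge D H) where
  open Bridge b

  H′ others lower upper : List Square
  H′     = H ∖ ends
  others = D ∖ (H′ ++ vertices walk)
  lower  = others ++ vertices walk
  upper  = others ++ interior walk

  others⁻ : ∀ {s} → s ∈ others → s ∈ D × s ∉ H′ × s ∉ vertices walk
  others⁻ s∈ = let s∈D , s∉ = ∈-∖⁻ s∈ in s∈D , s∉ ∘′ ∈-++⁺ˡ , s∉ ∘′ ∈-++⁺ʳ H′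

  others⁺ : ∀ {s} → s ∈ D → s ∉ H′ → s ∉ vertices walk → s ∈ others
  others⁺ s∈D s∉H′ s∉V = ∈-∖⁺ s∈D (Sum.[ s∉H′ , s∉V ] ∘′ ∈-++⁻ H′)

  others#vertices : Disjoint others (vertices walk)
  others#vertices (s∈ , s∈V) = proj₂ (proj₂ (others⁻ s∈)) s∈V

  others#interior : Disjoint others (interior walk)
  others#interior (s∈ , s∈I) = others#vertices (s∈ , interior⊆vertices walk s∈I)

  vertices#H′ : Disjoint (vertices walk) H′
  vertices#H′ (s∈V , s∈H′) with ∈-∖⁻ s∈H′ | vertices-cases walk s∈V
  ... | _ , s∉ends | inj₁ refl        = s∉ends (here refl)
  ... | s∈H , _    | inj₂ (inj₁ s∈I)  = lookup interior∉H s∈I s∈H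
  ... | _ , s∉ends | inj₂ (inj₂ refl) = s∉ends (there (here refl))

  others#H : Disjoint others H
  others#H {s} (s∈ , s∈H) with s ∈? ends | others⁻ s∈
  ... | yes (here refl)         | _ , _ , s∉V  = s∉V (source∈vertices walk)
  ... | yes (there (here refl)) | _ , _ , s∉V  = s∉V (target∈vertices walk)
  ... | no s∉ends               | _ , s∉H′ , _ = s∉H′ (∈-∖⁺ s∈H s∉ends)

  lower≐D∖H′ : (_∈ lower) ≐ (λ s → s ∈ D × s ∉ H′)
  lower≐D∖H′ = (λ s∈ → Sum.[ (λ s∈o → let s∈D , s∉H′ , _ = others⁻ s∈o in s∈D , s∉H′)
                            , (λ s∈V → lookup walk⊆D s∈V , λ s∈H′ → vertices#H′ (s∈V , s∈H′)) ] (∈-++⁻ others s∈))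
             , λ {s} (s∈D , s∉H′) → case s ∈? vertices walk of λ where
                 (yes s∈V) → ∈-++⁺ʳ others s∈V
                 (no s∉V)  → ∈-++⁺ˡ (others⁺ s∈D s∉H′ s∉V)

  upper⊆D : All (_∈ D) upper
  upper⊆D = All.++⁺ (All.tabulate (proj₁ ∘′ others⁻))
                    (All.tabulate (lookup walk⊆D ∘′ interior⊆vertices walk))

  H≐D∖upper : (_∈ H) ≐ (λ s → s ∈ D × s ∉ upper)
  H≐D∖upper = (λ s∈H → lookup H⊆D s∈H ,
                 Sum.[ (λ s∈o → others#H (s∈o , s∈H)) , (λ s∈I → lookup interior∉H s∈I s∈H) ] ∘′ ∈-++⁻ others)
            , λ {s} (s∈D , s∉upper) → case s ∈? H of λ where
                (yes s∈H) → s∈H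
                (no s∉H)  → ⊥-elim (s∉upper (∈-++⁺ˡ (others⁺ s∈D (s∉H ∘′ proj₁ ∘′ ∈-∖⁻) (off-walk s∉H s∉upper))))
    where
    off-walk : ∀ {s} → s ∉ H → s ∉ upper → s ∉ vertices walk
    off-walk s∉H s∉upper s∈V with vertices-cases walk s∈V
    ... | inj₁ refl        = s∉H source∈H
    ... | inj₂ (inj₁ s∈I)  = s∉upper (∈-++⁺ʳ others s∈I)
    ... | inj₂ (inj₂ refl) = s∉H target∈H

Cell : Set
Cell = ℕ × Square

Slab : ℕ → List Square → List Square → Pred Cell 0ℓ
Slab m A B (n , s) = n ≡ m × s ∈ A ⊎ n ≡ suc m × s ∈ B

Region : List Square → ℕ → List Square → Pred Cell 0ℓ
Region D m H (n , s) = s ∈ D × (n < m ⊎ n ≡ m × s ∈ H)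

Cork : List Square → ℕ → List Square → List Square → Pred Cell 0ℓ
Cork D m P Q (n , s) = s ∈ D × n ≤ m × ¬ (n ≡ 0 × s ∈ P) × ¬ (n ≡ m × s ∈ Q)

Region≐Cork : ∀ {D m p} → Region D m (D ∖ p) ≐ Cork D m [] p
Region≐Cork {D} {m} {p} = to , from
  where
  to : Region D m (D ∖ p) ⊆ Cork D m [] p
  to {_ , _} (s∈D , inj₁ n<m)          = s∈D , ℕP.<⇒≤ n<m , (λ ()) ∘′ proj₂ , λ (n≡m , _) → ℕP.<⇒≢ n<m n≡m
  to {_ , _} (s∈D , inj₂ (refl , s∈)) = s∈D , ℕP.≤-refl , (λ ()) ∘′ proj₂ , λ (_ , s∈p) → proj₂ (∈-∖⁻ {xs = D} s∈) s∈p
  from : Cork D m [] p ⊆ Region D m (D ∖ p)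
  from {_ , _} (s∈D , n≤m , _ , ¬top) with ℕP.m≤n⇒m<n∨m≡n n≤m
  ... | inj₁ n<m  = s∈D , inj₁ n<m
  ... | inj₂ refl = s∈D , inj₂ (refl , ∈-∖⁺ s∈D λ s∈p → ¬top (refl , s∈p))

IsTiling-resp : ∀ {R S T} → R ≐ S → IsTiling R T → IsTiling S T
IsTiling-resp (R⊆S , S⊆R) (adjacent , unique , covers) =
  adjacent , unique , λ x → mk⇔ (R⊆S ∘′ Equivalence.to (covers x)) (Equivalence.from (covers x) ∘′ S⊆R)

-- Layer n of a stack lies at height `level n`; reading a cork from the bottom
-- or from the top are the two instances used below.
module Stacking (level : ℕ → ℤ) (level-injective : ∀ {m n} → level m ≡ level n → m ≡ n)
                (level-step : ∀ n → ∣ level n ℤ.- level (suc n) ∣ ≡ 1) where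

  cube : Cell → Cube
  cube (n , (a , b)) = a , b , level n

  ⟦_⟧ : Pred Cell 0ℓ → Cube → Set
  ⟦ F ⟧ (a , b , c) = ∃[ n ] c ≡ level n × F (n , (a , b))

  Tiles : Pred Cell 0ℓ → List Domino → Set
  Tiles F = IsTiling ⟦ F ⟧

  ⟦⟧-resp : ∀ {F G} → F ≐ G → ⟦ F ⟧ ≐ ⟦ G ⟧
  ⟦⟧-resp (F⊆G , G⊆F) = (λ { {_ , _ , _} (n , c≡ , x∈F) → n , c≡ , F⊆G x∈F })
                     , (λ { {_ , _ , _} (n , c≡ , x∈G) → n , c≡ , G⊆F x∈G })

  Tiles-resp : ∀ {F G T} → F ≐ G → Tiles F T → Tiles G T
  Tiles-resp = IsTiling-resp ∘′ ⟦⟧-resp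

  Tiles-empty : ∀ {F} → (∀ {x} → ¬ F x) → Tiles F []
  Tiles-empty F-empty = [] , [] , λ { (_ , _ , _) → mk⇔ (λ ()) (λ (_ , _ , x∈F) → ⊥-elim (F-empty x∈F)) }

  Tiles-∪ : ∀ {F G T T′} → F ∩ G ⊆ ∅ → Tiles F T → Tiles G T′ → Tiles (F ∪ G) (T ++ T′)
  Tiles-∪ {F} {G} {T} {T′} F#G (adj , T! , covF) (adj′ , T′! , covG) =
    All.++⁺ adj adj′ , subst Unique (sym cells-++) (Unique.++⁺ T! T′! disjoint) , λ x → mk⇔ (to x) (from x)
    where
    cells-++ : cellsOf (T ++ T′) ≡ cellsOf T ++ cellsOf T′
    cells-++ = concatMap-++ _ T T′
    disjoint : Disjoint (cellsOf T) (cellsOf T′)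
    disjoint {_ , _ , _} (x∈T , x∈T′) with Equivalence.to (covF _) x∈T | Equivalence.to (covG _) x∈T′
    ... | n , refl , x∈F | _ , ℓn≡ℓn′ , x∈G with level-injective ℓn≡ℓn′
    ...   | refl = F#G (x∈F , x∈G)
    to : ∀ x → x ∈ cellsOf (T ++ T′) → ⟦ F ∪ G ⟧ x
    to x@(_ , _ , _) x∈ with ∈-++⁻ (cellsOf T) (subst (x ∈_) cells-++ x∈)
    ... | inj₁ x∈T  = let n , c≡ , x∈F = Equivalence.to (covF x) x∈T  in n , c≡ , inj₁ x∈F
    ... | inj₂ x∈T′ = let n , c≡ , x∈G = Equivalence.to (covG x) x∈T′ in n , c≡ , inj₂ x∈G
    from : ∀ x → ⟦ F ∪ G ⟧ x → x ∈ cellsOf (T ++ T′)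
    from x@(_ , _ , _) (n , c≡ , inj₁ x∈F) =
      subst (x ∈_) (sym cells-++) (∈-++⁺ˡ (Equivalence.from (covF x) (n , c≡ , x∈F)))
    from x@(_ , _ , _) (n , c≡ , inj₂ x∈G) =
      subst (x ∈_) (sym cells-++) (∈-++⁺ʳ (cellsOf T) (Equivalence.from (covG x) (n , c≡ , x∈G)))

  cube-injective : ∀ {c c′} → cube c ≡ cube c′ → c ≡ c′
  cube-injective {n , _} {n′ , _} eq with level-injective (cong (proj₂ ∘′ proj₂) eq) | cong (λ (a , b , _) → a , b) eq
  ... | refl | refl = refl

  Tiles-domino : ∀ {c c′} → AdjacentCubes (cube c) (cube c′) → c ≢ c′ →
                 Tiles (｛ c ｝ ∪ ｛ c′ ｝) ((cube c , cube c′) ∷ [])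
  Tiles-domino {c} {c′} adj c≢c′ =
    adj ∷ [] , ((c≢c′ ∘′ cube-injective) ∷ []) ∷ [] ∷ [] , λ x → mk⇔ (to x) (from x)
    where
    to : ∀ x → x ∈ cube c ∷ cube c′ ∷ [] → ⟦ ｛ c ｝ ∪ ｛ c′ ｝ ⟧ x
    to _ (here refl)         = proj₁ c  , refl , inj₁ refl
    to _ (there (here refl)) = proj₁ c′ , refl , inj₂ refl
    from : ∀ x → ⟦ ｛ c ｝ ∪ ｛ c′ ｝ ⟧ x → x ∈ cube c ∷ cube c′ ∷ []
    from (_ , _ , _) (_ , refl , inj₁ refl) = here refl
    from (_ , _ , _) (_ , refl , inj₂ refl) = there (here refl)

  Tiles-flat : ∀ n → Adjacent x y → Tiles (｛ n , x ｝ ∪ ｛ n , y ｝) ((cube (n , x) , cube (n , y)) ∷ [])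
  Tiles-flat {x@(a , b)} {y@(c , d)} n adj = Tiles-domino adj′ λ { refl → Adjacent-irreflexive {x} adj }
    where
    adj′ : AdjacentCubes (cube (n , x)) (cube (n , y))
    adj′ rewrite ∣i-i∣≡0 (level n) | ℕP.+-identityʳ (∣ a ℤ.- c ∣ + ∣ b ℤ.- d ∣) = adj

  Slab-++ : ∀ {m A A′ B B′ T T′} → Disjoint A A′ → Disjoint B B′ →
            Tiles (Slab m A B) T → Tiles (Slab m A′ B′) T′ → Tiles (Slab m (A ++ A′) (B ++ B′)) (T ++ T′)
  Slab-++ {m} {A} {A′} {B} {B′} A#A′ B#B′ tiles tiles′ = Tiles-resp (gather , split) (Tiles-∪ disjoint tiles tiles′)
    where
    disjoint : Slab m A B ∩ Slab m A′ B′ ⊆ ∅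
    disjoint {_ , _} (inj₁ (refl , s∈A) , inj₁ (_ , s∈A′)) = A#A′ (s∈A , s∈A′)
    disjoint {_ , _} (inj₁ (refl , _)   , inj₂ (m≡1+m , _)) = ℕP.1+n≢n (sym m≡1+m)
    disjoint {_ , _} (inj₂ (refl , _)   , inj₁ (1+m≡m , _)) = ℕP.1+n≢n 1+m≡m
    disjoint {_ , _} (inj₂ (refl , s∈B) , inj₂ (_ , s∈B′))  = B#B′ (s∈B , s∈B′)
    gather : Slab m A B ∪ Slab m A′ B′ ⊆ Slab m (A ++ A′) (B ++ B′)
    gather {_ , _} (inj₁ (inj₁ (n≡ , s∈))) = inj₁ (n≡ , ∈-++⁺ˡ s∈)
    gather {_ , _} (inj₁ (inj₂ (n≡ , s∈))) = inj₂ (n≡ , ∈-++⁺ˡ s∈)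
    gather {_ , _} (inj₂ (inj₁ (n≡ , s∈))) = inj₁ (n≡ , ∈-++⁺ʳ A s∈)
    gather {_ , _} (inj₂ (inj₂ (n≡ , s∈))) = inj₂ (n≡ , ∈-++⁺ʳ B s∈)
    split : Slab m (A ++ A′) (B ++ B′) ⊆ Slab m A B ∪ Slab m A′ B′
    split {_ , _} (inj₁ (n≡ , s∈)) = Sum.map (λ s∈A → inj₁ (n≡ , s∈A)) (λ s∈A′ → inj₁ (n≡ , s∈A′)) (∈-++⁻ A s∈)
    split {_ , _} (inj₂ (n≡ , s∈)) = Sum.map (λ s∈B → inj₂ (n≡ , s∈B)) (λ s∈B′ → inj₂ (n≡ , s∈B′)) (∈-++⁻ B s∈)

  Tiles-column : ∀ m x → Tiles (Slab m (x ∷ []) (x ∷ [])) ((cube (m , x) , cube (suc m , x)) ∷ [])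
  Tiles-column m x@(a , b) = Tiles-resp (to , from) (Tiles-domino adj λ ())
    where
    adj : AdjacentCubes (cube (m , x)) (cube (suc m , x))
    adj rewrite ∣i-i∣≡0 a | ∣i-i∣≡0 b = level-step m
    to : ｛ m , x ｝ ∪ ｛ suc m , x ｝ ⊆ Slab m (x ∷ []) (x ∷ [])
    to (inj₁ refl) = inj₁ (refl , here refl)
    to (inj₂ refl) = inj₂ (refl , here refl)
    from : Slab m (x ∷ []) (x ∷ []) ⊆ ｛ m , x ｝ ∪ ｛ suc m , x ｝
    from {_ , _} (inj₁ (refl , here refl)) = inj₁ refl
    from {_ , _} (inj₂ (refl , here refl)) = inj₂ refl

  Tiles-flat-lower : ∀ m → Adjacent x y → Tiles (Slab m (x ∷ y ∷ []) []) ((cube (m , x) , cube (m , y)) ∷ [])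
  Tiles-flat-lower {x} {y} m adj = Tiles-resp (to , from) (Tiles-flat m adj)
    where
    to : ｛ m , x ｝ ∪ ｛ m , y ｝ ⊆ Slab m (x ∷ y ∷ []) []
    to (inj₁ refl) = inj₁ (refl , here refl)
    to (inj₂ refl) = inj₁ (refl , there (here refl))
    from : Slab m (x ∷ y ∷ []) [] ⊆ ｛ m , x ｝ ∪ ｛ m , y ｝
    from {_ , _} (inj₁ (refl , here refl))         = inj₁ refl
    from {_ , _} (inj₁ (refl , there (here refl))) = inj₂ refl

  Tiles-flat-upper : ∀ m → Adjacent x y →
                     Tiles (Slab m [] (x ∷ y ∷ [])) ((cube (suc m , x) , cube (suc m , y)) ∷ [])
  Tiles-flat-upper {x} {y} m adj = Tiles-resp (to , from) (Tiles-flat (suc m) adj)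
    where
    to : ｛ suc m , x ｝ ∪ ｛ suc m , y ｝ ⊆ Slab m [] (x ∷ y ∷ [])
    to (inj₁ refl) = inj₂ (refl , here refl)
    to (inj₂ refl) = inj₂ (refl , there (here refl))
    from : Slab m [] (x ∷ y ∷ []) ⊆ ｛ suc m , x ｝ ∪ ｛ suc m , y ｝
    from {_ , _} (inj₂ (refl , here refl))         = inj₁ refl
    from {_ , _} (inj₂ (refl , there (here refl))) = inj₂ refl

  columns : List Square → ℕ → List Domino
  columns []       m = []
  columns (x ∷ xs) m = (cube (m , x) , cube (suc m , x)) ∷ columns xs m

  Tiles-columns : ∀ {xs} m → Unique xs → Tiles (Slab m xs xs) (columns xs m)
  Tiles-columns {[]}     m []         = Tiles-empty λ { {_ , _} (inj₁ (_ , ())) ; {_ , _} (inj₂ (_ , ())) }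
  Tiles-columns {x ∷ xs} m (x∉ ∷ xs!) = Slab-++ x#xs x#xs (Tiles-column m x) (Tiles-columns m xs!)
    where
    x#xs : Disjoint (x ∷ []) xs
    x#xs (here refl , x∈xs) = lookup x∉ x∈xs refl

  zigzag : OddWalk x y → ℕ → List Domino
  zigzag (edge {x} {y} _)        m = (cube (m , x) , cube (m , y)) ∷ []
  zigzag (zig {x} {y} {z} _ _ e) m =
    (cube (m , x) , cube (m , y)) ∷ (cube (suc m , y) , cube (suc m , z)) ∷ zigzag e m

  Tiles-zigzag : ∀ m (e : OddWalk x y) → Unique (vertices e) → Tiles (Slab m (vertices e) (interior e)) (zigzag e m)
  Tiles-zigzag m (edge a) _ = Tiles-flat-lower m a
  Tiles-zigzag m (zig {x} {y} {z} a b e) (x∉ ∷ y∉ ∷ e!) =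
    Slab-++ xy#e (λ ()) (Tiles-flat-lower m a) (Slab-++ (λ ()) yz#e (Tiles-flat-upper m b) (Tiles-zigzag m e e!))
    where
    xy#e : Disjoint (x ∷ y ∷ []) (vertices e)
    xy#e (here refl , s∈e)         = lookup x∉ (there s∈e) refl
    xy#e (there (here refl) , s∈e) = lookup y∉ s∈e refl
    yz#e : Disjoint (y ∷ z ∷ []) (interior e)
    yz#e (here refl , s∈e)         = lookup y∉ (interior⊆vertices e s∈e) refl
    yz#e (there (here refl) , s∈e) = proj₁ (interior-distinct e e! s∈e) refl

  module _ {D : List Square} where

    Region-zero : Tiles (Region D 0 []) []
    Region-zero = Tiles-empty λ { {_ , _} (_ , inj₂ (_ , ())) }

    Region-suc : ∀ {m H A B T T′} → (_∈ A) ≐ (λ s → s ∈ D × s ∉ H) → All (_∈ D) B →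
                 Tiles (Region D m H) T → Tiles (Slab m A B) T′ → Tiles (Region D (suc m) B) (T ++ T′)
    Region-suc {m} {H} {A} {B} (A⊆D∖H , D∖H⊆A) B⊆D below slab = Tiles-resp (to , from) (Tiles-∪ disjoint below slab)
      where
      disjoint : Region D m H ∩ Slab m A B ⊆ ∅
      disjoint {_ , _} ((_ , inj₁ n<m) , inj₁ (refl , _))         = ℕP.n≮n m n<m
      disjoint {_ , _} ((_ , inj₁ n<m) , inj₂ (refl , _))         = ℕP.n≮n m (ℕP.<-trans (ℕP.n<1+n m) n<m)
      disjoint {_ , _} ((_ , inj₂ (_ , s∈H)) , inj₁ (_ , s∈A))    = proj₂ (A⊆D∖H s∈A) s∈H
      disjoint {_ , _} ((_ , inj₂ (refl , _)) , inj₂ (m≡1+m , _)) = ℕP.1+n≢n (sym m≡1+m)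
      to : Region D m H ∪ Slab m A B ⊆ Region D (suc m) B
      to {_ , _} (inj₁ (s∈D , inj₁ n<m))        = s∈D , inj₁ (ℕP.m<n⇒m<1+n n<m)
      to {_ , _} (inj₁ (s∈D , inj₂ (refl , _))) = s∈D , inj₁ (ℕP.n<1+n m)
      to {_ , _} (inj₂ (inj₁ (refl , s∈A)))     = proj₁ (A⊆D∖H s∈A) , inj₁ (ℕP.n<1+n m)
      to {_ , _} (inj₂ (inj₂ (refl , s∈B)))     = lookup B⊆D s∈B , inj₂ (refl , s∈B)
      from : Region D (suc m) B ⊆ Region D m H ∪ Slab m A B
      from {_ , _} (_ , inj₂ (refl , s∈B)) = inj₂ (inj₂ (refl , s∈B))
      from {_ , s} (s∈D , inj₁ n<1+m) with ℕP.m<1+n⇒m<n∨m≡n n<1+m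
      ... | inj₁ n<m = inj₁ (s∈D , inj₁ n<m)
      ... | inj₂ refl with s ∈? H
      ...   | yes s∈H = inj₁ (s∈D , inj₂ (refl , s∈H))
      ...   | no  s∉H = inj₂ (inj₁ (refl , D∖H⊆A (s∈D , s∉H)))

    Region-suc-columns : ∀ {m H B T} → (_∈ B) ≐ (λ s → s ∈ D × s ∉ H) → Unique B →
                         Tiles (Region D m H) T → Tiles (Region D (suc m) B) (T ++ columns B m)
    Region-suc-columns {m} B≐D∖H B! below =
      Region-suc B≐D∖H (All.tabulate (proj₁ ∘′ proj₁ B≐D∖H)) below (Tiles-columns m B!)

    Region-suc-bridge : ∀ {m H T} → Unique D → Unique H → All (_∈ D) H → (b : Bridge D H) →
                        Tiles (Region D m (H ∖ Bridge.ends b)) T → ∃[ T′ ] Tiles (Region D (suc (suc m)) H) T′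
    Region-suc-bridge {m} D! H! H⊆D b below =
      _ , Region-suc-columns H≐D∖upper H! (Region-suc lower≐D∖H′ upper⊆D below slab)
      where
      open Bridge b
      open BridgeLayers H⊆D b
      slab : Tiles (Slab m lower upper) (columns others m ++ zigzag walk m)
      slab = Slab-++ others#vertices others#interior
               (Tiles-columns m (∖-unique (H′ ++ vertices walk) D!)) (Tiles-zigzag m walk walk-unique)

    module _ (D! : Unique D) (connected : EdgeConnected (_∈ D)) where

      Region-double : ∀ k {H} → Unique H → All (_∈ D) H → Balanced H → length H ≤ 2 * k →
                      ∃[ T ] Tiles (Region D (2 * k) H) T
      Region-double zero    {[]} _ _ _ _ = [] , Region-zero
      Region-double (suc k) {[]} _ _ _ _ rewrite ℕP.*-suc 2 k =
        _ , Region-suc-columns ((λ ()) , λ (s∈D , s∉D) → ⊥-elim (s∉D s∈D)) []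
              (Region-suc-columns ((λ s∈D → s∈D , λ ()) , proj₁) D! (proj₂ (Region-double k [] [] refl z≤n)))
      Region-double (suc k) {H@(_ ∷ _)} H! H⊆D balanced len rewrite ℕP.*-suc 2 k
        with s , t , s∈H , t∈H , opposite ← balanced-opposite balanced =
        Region-suc-bridge D! H! H⊆D b (proj₂ (Region-double k (∖-unique ends H!) H′⊆D
                                         (∖-balanced H! ends-unique ends⊆H balanced ends-balanced) len′))
        where
        b : Bridge D H
        b = bridge D H connected H⊆D s∈H t∈H opposite
        open Bridge b
        H′⊆D : All (_∈ D) (H ∖ ends)
        H′⊆D = All.tabulate (lookup H⊆D ∘′ proj₁ ∘′ ∈-∖⁻ {ys = ends})
        len′ : length (H ∖ ends) ≤ 2 * k
        len′ = ℕP.≤-pred (ℕP.≤-pred (subst (_≤ 2 + 2 * k) (↭-length (↭-++-∖ H! ends-unique ends⊆H)) len))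

      Region-plugged : Balanced D → ∀ m {p} → IsPlug D p → 2 * length D ≤ suc m →
                       ∃[ T ] Tiles (Region D m (D ∖ p)) T
      Region-plugged balanced m {p} (p! , p⊆D , p-balanced) bound with parity m
      ... | k , inj₁ refl =
        Region-double k (∖-unique p D!) (All.tabulate (proj₁ ∘′ ∈-∖⁻)) (∖-balanced D! p! p⊆D balanced p-balanced)
          (ℕP.≤-trans (length-filter (_∉? p) D) (length-bound D k balanced (ℕP.≤-trans bound (ℕP.n≤1+n _))))
      ... | k , inj₂ refl =
        _ , Region-suc-columns (∈-∖⁻ , λ (s∈D , s∉p) → ∈-∖⁺ s∈D s∉p) (∖-unique p D!)
              (proj₂ (Region-double k p! p⊆D p-balanced (ℕP.≤-trans p≤D (length-bound D k balanced bound))))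
        where
        p≤D : length p ≤ length D
        p≤D = subst (length p ≤_) (sym (trans (↭-length (↭-++-∖ D! p! p⊆D)) (length-++ p))) (ℕP.m≤m+n _ _)

∣n-[1+n]∣≡1 : ∀ n → ∣ + n ℤ.- + suc n ∣ ≡ 1
∣n-[1+n]∣≡1 n = cong ∣_∣ (shift (+ n))
  where
  shift : ∀ i → i ℤ.- (+ 1 ℤ.+ i) ≡ ℤ.- + 1
  shift = solve-∀

module Upward = Stacking +_ ℤP.+-injective ∣n-[1+n]∣≡1

module _ (m : ℕ) where

  fromTop : ℕ → ℤ
  fromTop n = + m ℤ.- + n

  fromTop-injective : ∀ {i j} → fromTop i ≡ fromTop j → i ≡ j
  fromTop-injective {i} {j} eq =
    ℤP.+-injective (trans (twice (+ m) (+ i)) (trans (cong (λ k → + m ℤ.- k) eq) (sym (twice (+ m) (+ j)))))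
    where
    twice : ∀ a i → i ≡ a ℤ.- (a ℤ.- i)
    twice = solve-∀

  ∣fromTop-suc∣≡1 : ∀ n → ∣ fromTop n ℤ.- fromTop (suc n) ∣ ≡ 1
  ∣fromTop-suc∣≡1 n = cong ∣_∣ (shift (+ m) (+ n))
    where
    shift : ∀ a i → (a ℤ.- i) ℤ.- (a ℤ.- (+ 1 ℤ.+ i)) ≡ + 1
    shift = solve-∀

  fromTop≡+[m∸n] : ∀ {n} → n ≤ m → fromTop n ≡ + (m ∸ n)
  fromTop≡+[m∸n] {n} n≤m = trans (ℤP.m-n≡m⊖n m n) (ℤP.⊖-≥ n≤m)

module Downward (m : ℕ) = Stacking (fromTop m) (fromTop-injective m) (∣fromTop-suc∣≡1 m)

-- In InCork the top layer + suc m - + 1 computes to + m.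
module _ {D : List Square} {m : ℕ} {P Q : List Square} where

  ⟦Cork⟧≐InCork : Upward.⟦ Cork D m P Q ⟧ ≐ InCork D (+ 0) (+ suc m) P Q
  ⟦Cork⟧≐InCork = from , to
    where
    to : InCork D (+ 0) (+ suc m) P Q ⊆ Upward.⟦ Cork D m P Q ⟧
    to {a , b , c} (s∈D , 0≤c , c<1+m , ¬bottom , ¬top) =
      ∣ c ∣ , sym +∣c∣≡c , s∈D , ℕP.≤-pred (ℤP.drop‿+<+ (subst (ℤ._< + suc m) (sym +∣c∣≡c) c<1+m)) ,
      (λ (∣c∣≡0 , s∈P) → ¬bottom (trans (sym +∣c∣≡c) (cong +_ ∣c∣≡0) , s∈P)) ,
      (λ (∣c∣≡m , s∈Q) → ¬top (trans (sym +∣c∣≡c) (cong +_ ∣c∣≡m) , s∈Q))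
      where
      +∣c∣≡c : + ∣ c ∣ ≡ c
      +∣c∣≡c = ℤP.0≤i⇒+∣i∣≡i 0≤c
    from : Upward.⟦ Cork D m P Q ⟧ ⊆ InCork D (+ 0) (+ suc m) P Q
    from {a , b , _} (n , refl , s∈D , n≤m , ¬bottom , ¬top) =
      s∈D , +≤+ z≤n , +<+ (s≤s n≤m) ,
      (λ (+n≡0 , s∈P) → ¬bottom (ℤP.+-injective +n≡0 , s∈P)) ,
      (λ (+n≡m , s∈Q) → ¬top (ℤP.+-injective +n≡m , s∈Q))

  ⟦Cork⟧≐InCork-fromTop : Downward.⟦_⟧ m (Cork D m Q P) ≐ InCork D (+ 0) (+ suc m) P Q
  ⟦Cork⟧≐InCork-fromTop = from , to
    where
    to : InCork D (+ 0) (+ suc m) P Q ⊆ Downward.⟦_⟧ m (Cork D m Q P)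
    to {a , b , c} (s∈D , 0≤c , c<1+m , ¬bottom , ¬top) =
      m ∸ j , c≡ , s∈D , ℕP.m∸n≤m m j ,
      (λ (n≡0 , s∈Q) → ¬top (trans (sym +j≡c) (cong +_ (trans j≡m∸n (cong (m ∸_) n≡0))) , s∈Q)) ,
      (λ (n≡m , s∈P) → ¬bottom (trans (sym +j≡c) (cong +_ (trans j≡m∸n (trans (cong (m ∸_) n≡m) (ℕP.n∸n≡0 m)))) , s∈P))
      where
      j : ℕ
      j = ∣ c ∣
      +j≡c : + j ≡ c
      +j≡c = ℤP.0≤i⇒+∣i∣≡i 0≤c
      j≡m∸n : j ≡ m ∸ (m ∸ j)
      j≡m∸n = sym (ℕP.m∸[m∸n]≡n (ℕP.≤-pred (ℤP.drop‿+<+ (subst (ℤ._< + suc m) (sym +j≡c) c<1+m))))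
      c≡ : c ≡ fromTop m (m ∸ j)
      c≡ = trans (sym +j≡c) (trans (cong +_ j≡m∸n) (sym (fromTop≡+[m∸n] m (ℕP.m∸n≤m m j))))
    from : Downward.⟦_⟧ m (Cork D m Q P) ⊆ InCork D (+ 0) (+ suc m) P Q
    from {a , b , _} (n , refl , s∈D , n≤m , ¬bottom , ¬top) =
      s∈D , subst (+ 0 ℤ.≤_) (sym c≡) (+≤+ z≤n) , subst (ℤ._< + suc m) (sym c≡) (+<+ (s≤s (ℕP.m∸n≤m m n))) ,
      (λ (c≡0 , s∈P) → ¬top (trans n≡m∸c (cong (m ∸_) (ℤP.+-injective (trans (sym c≡) c≡0))) , s∈P)) ,
      (λ (c≡m , s∈Q) → ¬bottom (trans n≡m∸c (trans (cong (m ∸_) (ℤP.+-injective (trans (sym c≡) c≡m))) (ℕP.n∸n≡0 m)) , s∈Q))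
      where
      c≡ : fromTop m n ≡ + (m ∸ n)
      c≡ = fromTop≡+[m∸n] m n≤m
      n≡m∸c : n ≡ m ∸ (m ∸ n)
      n≡m∸c = sym (ℕP.m∸[m∸n]≡n n≤m)

cork-tilings : ∀ {D} → Unique D → EdgeConnected (_∈ D) → Balanced D → ∀ m {p} → IsPlug D p → 2 * length D ≤ suc m →
               Tileable (InCork D (+ 0) (+ suc m) [] p) × Tileable (InCork D (+ 0) (+ suc m) p [])
cork-tilings D! connected balanced m plug bound =
  (_ , IsTiling-resp ⟦Cork⟧≐InCork
         (Upward.Tiles-resp Region≐Cork (proj₂ (Upward.Region-plugged D! connected balanced m plug bound)))) ,
  (_ , IsTiling-resp ⟦Cork⟧≐InCork-fromTop
         (Downward.Tiles-resp m Region≐Cork (proj₂ (Downward.Region-plugged m D! connected balanced m plug bound))))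

lemma4p1 : (D : List Square) → IsQuadDisk D → Balanced D
         → (N : ℕ) → 2 * length D ≤ N
         → (p : List Square) → IsPlug D p
         → Tileable (InCork D (+ 0) (+ N) [] p) × Tileable (InCork D (+ 0) (+ N) p [])
lemma4p1 []      (_ , D≢[] , _) _ _ _ _ _ = ⊥-elim (D≢[] refl)
lemma4p1 (_ ∷ _) _ _ zero () _ _
lemma4p1 D@(_ ∷ _) (D! , _ , connected , _) balanced (suc m) bound _ plug =
  cork-tilings D! connected balanced m plug bound
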